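{- Let $G$ be a simple graph with $E(G)\neq\emptyset$, let $\trianglelefteq$ be a linear order on $E(G)$, and let $e=\{v_1,v_2\}$ be the $\trianglelefteq$-maximal edge. Then the map $T\mapsto(T_1,T_2)$, where $T-e=T_1\sqcup T_2$ with $T_i$ the component tree containing $v_i$, is a well-defined bijection $$\mathcal{N}(G)\to\bigsqcup_{\substack{\{S_1,S_2\}:\ S_1\sqcup S_2=V(G)\\ v_i\in S_i,\ G[S_i]\text{ connected}}}\mathcal{N}(G[S_1])\times\mathcal{N}(G[S_2]),$$ where $(T_1,T_2)$ lies in the term indexed by $S_i=V(T_i)$.
   Context: For a simple graph $H$ whose edges are linearly ordered by $\trianglelefteq$ (restricting the order on $E(G)$ for induced subgraphs $H=G[S]$), a broken circuit is the edge set of a cycle of $H$ with its $\trianglelefteq$-maximal edge removed. $\mathcal{N}(H)$ is the set of (edge sets of) spanning trees of $H$ containing no broken circuit as a subset (for a one-vertex graph this is $\{\emptyset\}$). $G[S]$ is the subgraph induced by $S$. -}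

module Defs where

open import Level using (0ℓ)
open import Data.Nat using (ℕ; suc)
open import Data.Fin using (Fin; zero; suc; inject₁; fromℕ)
open import Data.Fin.Subset using (Subset; _∈_)
open import Data.Product using (Σ; ∃; _×_; _,_; proj₁; proj₂)
open import Data.Sum using (_⊎_)
open import Relation.Binary.PropositionalEquality using (_≡_; _≢_)
open import Relation.Binary.Core using (Rel)
open import Relation.Binary.Construct.Closure.ReflexiveTransitive using (Star)
open import Relation.Nullary using (¬_)
open import Function.Definitions using (Injective)
open import Function.Bundles using (_⇔_)

-- Edge f has endpoints ends f (stored as an ordered pair, read as an
-- unordered pair {u , v}); no loops, no parallel edges.
record Graph (n : ℕ) : Set where
  field
    m          : ℕ
    ends       : Fin m → Fin n × Fin n
    loopless   : ∀ f → proj₁ (ends f) ≢ proj₂ (ends f)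

  Joins : Fin m → Fin n → Fin n → Set
  Joins f u v = (ends f ≡ (u , v)) ⊎ (ends f ≡ (v , u))

  field
    noParallel : ∀ f g u v → Joins f u v → Joins g u v → f ≡ g

module _ {n : ℕ} (G : Graph n) where
  open Graph G

  EdgeIn : Subset n → Fin m → Set
  EdgeIn S f = (proj₁ (ends f) ∈ S) × (proj₂ (ends f) ∈ S)

  Adj : (Fin m → Set) → Fin n → Fin n → Set
  Adj P u v = ∃ λ f → P f × Joins f u v

  Reach : (Fin m → Set) → Fin n → Fin n → Set
  Reach P = Star (Adj P)

  ConnectedInduced : Subset n → Set
  ConnectedInduced S = ∀ u v → u ∈ S → v ∈ S → Reach (EdgeIn S) u v

  -- A cycle of G with L+1 ≥ 3 distinct vertices vs 0, …, vs L.
  -- Its edges are  cedge zero = {vs L , vs 0}  and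
  -- cedge (suc i) = {vs i , vs (i+1)}  for i < L.
  record Cycle : Set where
    field
      L        : ℕ
      long     : 2 Data.Nat.≤ L
      vs       : Fin (suc L) → Fin n
      distinct : Injective _≡_ _≡_ vs
      cedge    : Fin (suc L) → Fin m
      closing  : Joins (cedge zero) (vs (fromℕ L)) (vs zero)
      path     : ∀ (i : Fin L) → Joins (cedge (suc i)) (vs (inject₁ i)) (vs (suc i))

  CycleIn : Subset n → Cycle → Set
  CycleIn S c = ∀ i → Cycle.vs c i ∈ S

  module _ (_⊴_ : Rel (Fin m) 0ℓ) where

    BrokenCircuitIn : Subset m → Cycle → Set
    BrokenCircuitIn T c = ∃ λ j →
        (∀ i → Cycle.cedge c i ⊴ Cycle.cedge c j)
      × (∀ i → i ≢ j → Cycle.cedge c i ∈ T)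

    NBC : Subset n → Subset m → Set
    NBC S T =
        (∀ f → f ∈ T → EdgeIn S f)
      × (∀ u v → u ∈ S → v ∈ S → Reach (_∈ T) u v)
      × (∀ (c : Cycle) → ¬ (∀ i → Cycle.cedge c i ∈ T))
      × (∀ (c : Cycle) → CycleIn S c → ¬ BrokenCircuitIn T c)

  Index : Fin n → Fin n → Subset n → Subset n → Set
  Index v₁ v₂ S₁ S₂ =
      (∀ u → (u ∈ S₁) ⊎ (u ∈ S₂))
    × (∀ u → u ∈ S₁ → ¬ (u ∈ S₂))
    × (v₁ ∈ S₁) × (v₂ ∈ S₂)
    × ConnectedInduced S₁ × ConnectedInduced S₂

  Minus : Subset m → Fin m → Fin m → Set
  Minus T e f = (f ∈ T) × (f ≢ e)

  Split : Fin m → Fin n → Fin n → Subset m →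
          Subset n → Subset n → Subset m → Subset m → Set
  Split e v₁ v₂ T S₁ S₂ T₁ T₂ =
      (∀ u → (u ∈ S₁) ⇔ Reach (Minus T e) v₁ u)
    × (∀ u → (u ∈ S₂) ⇔ Reach (Minus T e) v₂ u)
    × (∀ f → (f ∈ T₁) ⇔ (Minus T e f × EdgeIn S₁ f))
    × (∀ f → (f ∈ T₂) ⇔ (Minus T e f × EdgeIn S₂ f))

-- Because e is the ⊴-greatest edge, a walk in T − e between v₁ and v₂ would close up with e
-- to a cycle whose broken circuit lies in T. So for T ∈ 𝒩(G), deleting e splits T into the
-- trees through v₁ and v₂, which inherit the NBC property because cycles of G[Sᵢ] are cycles
-- of G; and T = T₁ ∪ T₂ ∪ {e}, giving injectivity. Conversely T₁ ∪ T₂ ∪ {e} is an NBC tree: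
-- a broken circuit in it avoids e (only the maximal edge of a cycle can be e), so it is a path
-- in T₁ ∪ T₂ and cannot leave the Sᵢ it starts in; hence the removed edge is not the crossing
-- edge e either, and the broken circuit would lie in Tᵢ.
module Submission where

open import Defs
open import Level using (Level; 0ℓ)
open import Data.Nat using (ℕ; zero; suc; z≤n; s≤s; _≤_; _<_; _≤?_)
import Data.Nat.Properties as ℕ
open import Data.Fin using (Fin; zero; suc; inject₁; fromℕ; toℕ; _≟_)
open import Data.Fin.Properties using (suc-injective; toℕ-inject₁; toℕ≤pred[n]; any?; <⇒≢)
open import Data.Fin.Subset using (Subset; ⊤; _∈_; _∉_; _∪_; ⁅_⁆)
open import Data.Fin.Subset.Properties using (∈⊤; ⊆-antisym; x∈p∪q⁺; x∈p∪q⁻; x∈⁅x⁆; x∈⁅y⁆⇒x≡y; _∈?_)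
open import Data.Vec using ([]; _∷_; here; there)
open import Data.Product using (Σ; ∃; _×_; _,_; proj₁; proj₂) renaming (swap to swap′)
open import Data.Product.Properties using (,-injective)
open import Data.Sum using (_⊎_; inj₁; inj₂; [_,_]; swap)
import Data.Sum as Sum
open import Data.Empty using (⊥; ⊥-elim)
open import Data.Unit using (tt) renaming (⊤ to Unit)
open import Function using (_∘_; const)
open import Function.Definitions using (Injective)
open import Function.Bundles using (_⇔_; mk⇔; Equivalence)
open import Relation.Nullary using (¬_; yes; no; does; contradiction; ¬?; _×-dec_)
open import Relation.Unary using (Decidable)
open import Relation.Binary.Core using (Rel)
open import Relation.Binary.Structures using (IsTotalOrder)
open import Relation.Binary.PropositionalEquality using (_≡_; _≢_; refl; sym; trans; cong; subst)
open import Relation.Binary.Construct.Closure.ReflexiveTransitive using (Star; ε; _◅_; _◅◅_; reverse)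
import Relation.Binary.Construct.Closure.ReflexiveTransitive as Star

open Equivalence using (to; from)

module _ {a ℓ : Level} {A : Set a} {R : Rel A ℓ} where

  chain-from-start : ∀ {L} (x : Fin (suc L) → A) b →
    (∀ (i : Fin L) → toℕ i < b → R (x (inject₁ i)) (x (suc i))) →
    ∀ t → toℕ t ≤ b → Star R (x zero) (x t)
  chain-from-start x b steps zero _ = ε
  chain-from-start {suc L} x (suc b) steps (suc t) (s≤s t≤b) =
    steps zero (s≤s z≤n) ◅ chain-from-start (x ∘ suc) b (λ i i<b → steps (suc i) (s≤s i<b)) t t≤b

  chain-to-end : ∀ {L} (x : Fin (suc L) → A) b →
    (∀ (i : Fin L) → b ≤ toℕ i → R (x (inject₁ i)) (x (suc i))) →
    ∀ t → b ≤ toℕ t → Star R (x t) (x (fromℕ L))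
  chain-to-end {zero} x b steps zero _ = ε
  chain-to-end {suc L} x zero steps zero _ =
    steps zero z≤n ◅ chain-to-end (x ∘ suc) zero (λ i _ → steps (suc i) z≤n) zero z≤n
  chain-to-end {suc L} x zero steps (suc t) _ =
    chain-to-end (x ∘ suc) zero (λ i _ → steps (suc i) z≤n) t z≤n
  chain-to-end {suc L} x (suc b) steps (suc t) (s≤s b≤t) =
    chain-to-end (x ∘ suc) b (λ i b≤i → steps (suc i) (s≤s b≤i)) t b≤t

module _ {a ℓ : Level} {A : Set a} {_≤_ : Rel A ℓ} (isTotalOrder : IsTotalOrder _≡_ _≤_) where
  open IsTotalOrder isTotalOrder using (total) renaming (refl to ≤-refl; trans to ≤-trans)

  argmax : ∀ {L} (x : Fin (suc L) → A) → ∃ λ j → ∀ i → x i ≤ x j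
  argmax {zero} x = zero , λ { zero → ≤-refl }
  argmax {suc L} x with argmax (x ∘ suc)
  ... | j , max with total (x zero) (x (suc j))
  ...   | inj₁ x₀≤ = suc j , λ { zero → x₀≤ ; (suc i) → max i }
  ...   | inj₂ ≤x₀ = zero , λ { zero → ≤-refl ; (suc i) → ≤-trans (max i) ≤x₀ }

ofDecidable : ∀ {n p} {P : Fin n → Set p} → Decidable P → Subset n
ofDecidable {zero} P? = []
ofDecidable {suc n} P? = does (P? zero) ∷ ofDecidable (P? ∘ suc)

∈-ofDecidable : ∀ {n p} {P : Fin n → Set p} (P? : Decidable P) x → x ∈ ofDecidable P? ⇔ P x
∈-ofDecidable P? zero with P? zero
... | yes p = mk⇔ (const p) (const here)
... | no ¬p = mk⇔ (λ ()) (λ p → contradiction p ¬p)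
∈-ofDecidable P? (suc x) = mk⇔ (λ { (there h) → to (∈-ofDecidable (P? ∘ suc) x) h })
                               (there ∘ from (∈-ofDecidable (P? ∘ suc) x))

Subset-ext : ∀ {n} {p q : Subset n} → (∀ x → x ∈ p ⇔ x ∈ q) → p ≡ q
Subset-ext p⇔q = ⊆-antisym (λ {x} → to (p⇔q x)) (λ {x} → from (p⇔q x))

module _ {n : ℕ} (G : Graph n) where
  open Graph G

  Joins-sym : ∀ {f a b} → Joins f a b → Joins f b a
  Joins-sym (inj₁ p) = inj₂ p
  Joins-sym (inj₂ p) = inj₁ p

  Joins-unique : ∀ {f a b c d} → Joins f a b → Joins f c d → (a ≡ c × b ≡ d) ⊎ (a ≡ d × b ≡ c)
  Joins-unique (inj₁ p) (inj₁ q) = inj₁ (,-injective (trans (sym p) q))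
  Joins-unique (inj₁ p) (inj₂ q) = inj₂ (,-injective (trans (sym p) q))
  Joins-unique (inj₂ p) (inj₁ q) = inj₂ (swap′ (,-injective (trans (sym p) q)))
  Joins-unique (inj₂ p) (inj₂ q) = inj₁ (swap′ (,-injective (trans (sym p) q)))

  Joins-irrefl : ∀ {f a} → ¬ Joins f a a
  Joins-irrefl {f} (inj₁ p) = loopless f (trans (cong proj₁ p) (sym (cong proj₂ p)))
  Joins-irrefl {f} (inj₂ p) = loopless f (trans (cong proj₁ p) (sym (cong proj₂ p)))

  EdgeIn-intro : ∀ {S f a b} → Joins f a b → a ∈ S → b ∈ S → EdgeIn G S f
  EdgeIn-intro {S} (inj₁ p) a∈S b∈S = subst (λ ab → proj₁ ab ∈ S × proj₂ ab ∈ S) (sym p) (a∈S , b∈S)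
  EdgeIn-intro {S} (inj₂ p) a∈S b∈S = subst (λ ab → proj₁ ab ∈ S × proj₂ ab ∈ S) (sym p) (b∈S , a∈S)

  EdgeIn-ends : ∀ {S f a b} → Joins f a b → EdgeIn G S f → a ∈ S × b ∈ S
  EdgeIn-ends {S} (inj₁ p) f∈S = subst (λ ab → proj₁ ab ∈ S × proj₂ ab ∈ S) p f∈S
  EdgeIn-ends {S} (inj₂ p) f∈S = swap′ (subst (λ ab → proj₁ ab ∈ S × proj₂ ab ∈ S) p f∈S)

  Reach-sym : ∀ {P a b} → Reach G P a b → Reach G P b a
  Reach-sym = reverse λ (f , pf , j) → f , pf , Joins-sym j

  Reach-mono : ∀ {P Q : Fin m → Set} → (∀ f → P f → Q f) → ∀ {a b} → Reach G P a b → Reach G Q a b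
  Reach-mono P⇒Q = Star.map λ (f , pf , j) → f , P⇒Q f pf , j

  Reach-closed : ∀ {P} {Q : Fin n → Set} → (∀ {f a b} → P f → Joins f a b → Q a → Q b) →
    ∀ {a b} → Reach G P a b → Q a → Q b
  Reach-closed closed ε qa = qa
  Reach-closed closed ((f , pf , j) ◅ r) qa = Reach-closed closed r (closed pf j qa)

  reach-minus-edge : ∀ {T e v₁ v₂ u} → Joins e v₁ v₂ → Reach G (_∈ T) v₁ u →
    Reach G (Minus G T e) v₁ u ⊎ Reach G (Minus G T e) v₂ u
  reach-minus-edge {T} {e} {v₁} {v₂} e-joins r = go r (inj₁ ε)
    where
    go : ∀ {a u} → Reach G (_∈ T) a u →
      Reach G (Minus G T e) v₁ a ⊎ Reach G (Minus G T e) v₂ a →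
      Reach G (Minus G T e) v₁ u ⊎ Reach G (Minus G T e) v₂ u
    go ε h = h
    go ((f , f∈T , jf) ◅ r) h with f ≟ e
    ... | no f≢e = go r (Sum.map (_◅◅ step) (_◅◅ step) h)
      where
      step : Reach G (Minus G T e) _ _
      step = (f , (f∈T , f≢e) , jf) ◅ ε
    ... | yes refl with Joins-unique jf e-joins
    ...   | inj₁ (_ , refl) = go r (inj₂ ε)
    ...   | inj₂ (_ , refl) = go r (inj₁ ε)

  length : ∀ {P u w} → Reach G P u w → ℕ
  length ε = zero
  length (_ ◅ p) = suc (length p)

  vertex : ∀ {P u w} (p : Reach G P u w) → Fin (suc (length p)) → Fin n
  vertex {u = u} p zero = u
  vertex (_ ◅ p) (suc i) = vertex p i

  edge : ∀ {P u w} (p : Reach G P u w) → Fin (length p) → Fin m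
  edge ((f , _) ◅ p) zero = f
  edge (_ ◅ p) (suc i) = edge p i

  vertex-last : ∀ {P u w} (p : Reach G P u w) → vertex p (fromℕ (length p)) ≡ w
  vertex-last ε = refl
  vertex-last (_ ◅ p) = vertex-last p

  edge-satisfies : ∀ {P u w} (p : Reach G P u w) i → P (edge p i)
  edge-satisfies ((f , pf , _) ◅ p) zero = pf
  edge-satisfies (_ ◅ p) (suc i) = edge-satisfies p i

  edge-joins : ∀ {P u w} (p : Reach G P u w) i → Joins (edge p i) (vertex p (inject₁ i)) (vertex p (suc i))
  edge-joins ((_ , _ , j) ◅ _) zero = j
  edge-joins (_ ◅ p) (suc i) = edge-joins p i

  Simple : ∀ {P u w} → Reach G P u w → Set
  Simple ε = Unit
  Simple {u = u} (_ ◅ p) = (∀ i → vertex p i ≢ u) × Simple p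

  vertex-injective : ∀ {P u w} (p : Reach G P u w) → Simple p → Injective _≡_ _≡_ (vertex p)
  vertex-injective p _ {zero} {zero} _ = refl
  vertex-injective (_ ◅ p) (fresh , _) {zero} {suc j} eq = ⊥-elim (fresh j (sym eq))
  vertex-injective (_ ◅ p) (fresh , _) {suc i} {zero} eq = ⊥-elim (fresh i eq)
  vertex-injective (_ ◅ p) (_ , simple) {suc i} {suc j} eq = cong suc (vertex-injective p simple eq)

  simple-suffix : ∀ {P u w} (p : Reach G P u w) → Simple p → ∀ i → Σ (Reach G P (vertex p i) w) Simple
  simple-suffix p simple zero = p , simple
  simple-suffix (_ ◅ p) (_ , simple) (suc i) = simple-suffix p simple i

  -- Loop erasure: if u already occurs on the simplified tail, keep only the part after it.
  simplify : ∀ {P u w} → Reach G P u w → Σ (Reach G P u w) Simple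
  simplify ε = ε , tt
  simplify {P} {u} {w} (s ◅ r) with simplify r
  ... | p , simple with any? (λ i → vertex p i ≟ u)
  ...   | yes (i , visited) = subst (λ x → Σ (Reach G P x w) Simple) visited (simple-suffix p simple i)
  ...   | no fresh = (s ◅ p) , (λ i eq → fresh (i , eq)) , simple

  closeCycle : ∀ {P a b f} (p : Reach G P a b) → Simple p → 2 ≤ length p → Joins f b a → Cycle G
  closeCycle {f = f} p simple long f-joins = record
    { L = length p
    ; long = long
    ; vs = vertex p
    ; distinct = vertex-injective p simple
    ; cedge = λ { zero → f ; (suc i) → edge p i }
    ; closing = subst (λ x → Joins f x _) (sym (vertex-last p)) f-joins
    ; path = edge-joins p
    }

  prev : ∀ {L} → Fin (suc L) → Fin (suc L)
  prev {L} zero = fromℕ L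
  prev (suc i) = inject₁ i

  prev∘prev≢id : ∀ {L} → 2 ≤ L → (j : Fin (suc L)) → prev (prev j) ≢ j
  prev∘prev≢id {suc zero} (s≤s ()) _
  prev∘prev≢id {suc (suc L)} _ zero ()
  prev∘prev≢id {suc (suc L)} _ (suc zero) ()
  prev∘prev≢id {suc (suc L)} _ (suc (suc k)) eq =
    ℕ.<⇒≢ (ℕ.m<n⇒m<1+n (ℕ.n<1+n (toℕ k)))
      (trans (sym (trans (toℕ-inject₁ (inject₁ k)) (toℕ-inject₁ k))) (cong toℕ eq))

  Cycle-joins : (c : Cycle G) → ∀ i → Joins (Cycle.cedge c i) (Cycle.vs c (prev i)) (Cycle.vs c i)
  Cycle-joins c zero = Cycle.closing c
  Cycle-joins c (suc i) = Cycle.path c i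

  cedge-injective : (c : Cycle G) → Injective _≡_ _≡_ (Cycle.cedge c)
  cedge-injective c {i} {j} eq
    with Joins-unique (Cycle-joins c i) (subst (λ f → Joins f _ _) (sym eq) (Cycle-joins c j))
  ... | inj₁ (_ , vᵢ≡vⱼ) = Cycle.distinct c vᵢ≡vⱼ
  ... | inj₂ (vᵢ₋₁≡vⱼ , vᵢ≡vⱼ₋₁) = ⊥-elim (prev∘prev≢id (Cycle.long c) j
      (trans (cong prev (sym (Cycle.distinct c vᵢ≡vⱼ₋₁))) (Cycle.distinct c vᵢ₋₁≡vⱼ)))

  cycle-minus-edge-connected : ∀ {P} (c : Cycle G) (j : Fin (suc (Cycle.L c))) →
    (∀ i → i ≢ j → P (Cycle.cedge c i)) → ∀ a b → Reach G P (Cycle.vs c a) (Cycle.vs c b)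
  cycle-minus-edge-connected {P} c j kept a b = Reach-sym (from-first j kept a) ◅◅ from-first j kept b
    where
    open Cycle c

    step : ∀ {j} → (∀ i → i ≢ j → P (cedge i)) →
      ∀ (i : Fin L) → suc i ≢ j → Adj G P (vs (inject₁ i)) (vs (suc i))
    step kept i i≢j = cedge (suc i) , kept (suc i) i≢j , path i

    -- Without edge suc k, vertices up to k are reached forwards from vs zero and
    -- the others backwards through the closing edge.
    from-first : ∀ j → (∀ i → i ≢ j → P (cedge i)) → ∀ t → Reach G P (vs zero) (vs t)
    from-first zero kept t = chain-from-start vs L (λ i _ → step kept i λ ()) t (toℕ≤pred[n] t)
    from-first (suc k) kept t with toℕ t ≤? toℕ k
    ... | yes t≤k =
      chain-from-start vs (toℕ k) (λ i i<k → step kept i (<⇒≢ i<k ∘ suc-injective)) t t≤k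
    ... | no t≰k =
      (cedge zero , kept zero (λ ()) , Joins-sym closing) ◅
      Reach-sym (chain-to-end vs (suc (toℕ k)) (λ i k<i → step kept i (<⇒≢ k<i ∘ sym ∘ suc-injective))
                              t (ℕ.≰⇒> t≰k))

  module _ (_⊴_ : Rel (Fin m) 0ℓ) (isTotalOrder : IsTotalOrder _≡_ _⊴_) where
    open IsTotalOrder isTotalOrder using (antisym)

    NoBrokenCircuit : Subset m → Set
    NoBrokenCircuit T = ∀ (c : Cycle G) → CycleIn G ⊤ c → ¬ BrokenCircuitIn G _⊴_ T c

    NBC⇒connected : ∀ {S T} → NBC G _⊴_ S T → ConnectedInduced G S
    NBC⇒connected (T⊆E[S] , spanning , _) u v u∈S v∈S = Reach-mono T⊆E[S] (spanning u v u∈S v∈S)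

    cycle-has-broken-circuit : ∀ {T} (c : Cycle G) → (∀ i → Cycle.cedge c i ∈ T) → BrokenCircuitIn G _⊴_ T c
    cycle-has-broken-circuit c c⊆T =
      let j , max = argmax isTotalOrder (Cycle.cedge c) in j , max , λ i _ → c⊆T i

    other-cycle-edges≢greatest : ∀ {e} (c : Cycle G) {j} → (∀ i → Cycle.cedge c i ⊴ Cycle.cedge c j) →
      (∀ f → f ⊴ e) → ∀ i → i ≢ j → Cycle.cedge c i ≢ e
    other-cycle-edges≢greatest c max greatest i i≢j refl =
      i≢j (cedge-injective c (antisym (max i) (greatest _)))

    greatest-edge-separates : ∀ {T e a b} → (∀ f → f ⊴ e) → NoBrokenCircuit T →
      Joins e a b → ¬ Reach G (Minus G T e) a b
    greatest-edge-separates {T} {e} greatest noBC e-joins r with simplify r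
    ... | ε , _ = Joins-irrefl e-joins
    ... | (f , (_ , f≢e) , f-joins) ◅ ε , _ = f≢e (noParallel f e _ _ f-joins e-joins)
    ... | p@(_ ◅ _ ◅ _) , simple = noBC cycle (λ _ → ∈⊤) (zero , (λ _ → greatest _) , rest⊆T)
      where
      cycle : Cycle G
      cycle = closeCycle p simple (s≤s (s≤s z≤n)) (Joins-sym e-joins)
      rest⊆T : ∀ i → i ≢ zero → Cycle.cedge cycle i ∈ T
      rest⊆T zero 0≢0 = contradiction refl 0≢0
      rest⊆T (suc i) _ = proj₁ (edge-satisfies p i)

    component-NBC : ∀ {T P w S T′} → NBC G _⊴_ ⊤ T → (∀ f → P f → f ∈ T) →
      (∀ u → u ∈ S ⇔ Reach G P w u) → (∀ f → f ∈ T′ ⇔ (P f × EdgeIn G S f)) → NBC G _⊴_ S T′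
    component-NBC {T} {P} {w} {S} {T′} (_ , _ , acyclic , noBC) P⊆T S⇔ T′⇔ =
        (λ f → proj₂ ∘ to (T′⇔ f))
      , spanning
      , (λ c c⊆T′ → acyclic c (T′⊆T ∘ c⊆T′))
      , (λ c _ (j , max , rest) → noBC c (λ _ → ∈⊤) (j , max , λ i i≢j → T′⊆T (rest i i≢j)))
      where
      T′⊆T : ∀ {f} → f ∈ T′ → f ∈ T
      T′⊆T {f} = P⊆T f ∘ proj₁ ∘ to (T′⇔ f)

      w∈S : w ∈ S
      w∈S = from (S⇔ w) ε

      walk-in : ∀ {a b} → Reach G P a b → a ∈ S → Reach G (_∈ T′) a b
      walk-in ε _ = ε
      walk-in {a} ((f , pf , f-joins) ◅ r) a∈S =
        (f , from (T′⇔ f) (pf , EdgeIn-intro f-joins a∈S b∈S) , f-joins) ◅ walk-in r b∈S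
        where
        b∈S : _ ∈ S
        b∈S = from (S⇔ _) (to (S⇔ a) a∈S ◅◅ ((f , pf , f-joins) ◅ ε))

      spanning : ∀ u v → u ∈ S → v ∈ S → Reach G (_∈ T′) u v
      spanning u v u∈S v∈S = Reach-sym (walk-in (to (S⇔ u) u∈S) w∈S) ◅◅ walk-in (to (S⇔ v) v∈S) w∈S

    module Bijection {e : Fin m} (greatest : ∀ f → f ⊴ e) {v₁ v₂ : Fin n} (e-joins : Joins e v₁ v₂) where

      module Components {T} (N : NBC G _⊴_ ⊤ T) where
        private
          spanning : ∀ u v → u ∈ ⊤ → v ∈ ⊤ → Reach G (_∈ T) u v
          spanning = proj₁ (proj₂ N)

        separated : ¬ Reach G (Minus G T e) v₁ v₂
        separated = greatest-edge-separates greatest (proj₂ (proj₂ (proj₂ N))) e-joins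

        e∈T : e ∈ T
        e∈T with e ∈? T
        ... | yes e∈T = e∈T
        ... | no e∉T = contradiction
          (Reach-mono (λ f f∈T → f∈T , λ { refl → e∉T f∈T }) (spanning v₁ v₂ ∈⊤ ∈⊤)) separated

        sides : ∀ u → Reach G (Minus G T e) v₁ u ⊎ Reach G (Minus G T e) v₂ u
        sides u = reach-minus-edge e-joins (spanning v₁ u ∈⊤ ∈⊤)

        reach₁? : Decidable (Reach G (Minus G T e) v₁)
        reach₁? u with sides u
        ... | inj₁ r₁ = yes r₁
        ... | inj₂ r₂ = no λ r₁ → separated (r₁ ◅◅ Reach-sym r₂)

        reach₂? : Decidable (Reach G (Minus G T e) v₂)
        reach₂? u with sides u
        ... | inj₁ r₁ = no λ r₂ → separated (r₁ ◅◅ Reach-sym r₂)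
        ... | inj₂ r₂ = yes r₂

        component-edge? : ∀ S → Decidable (λ f → Minus G T e f × EdgeIn G S f)
        component-edge? S f =
          ((f ∈? T) ×-dec ¬? (f ≟ e)) ×-dec ((proj₁ (ends f) ∈? S) ×-dec (proj₂ (ends f) ∈? S))

        S₁ S₂ : Subset n
        S₁ = ofDecidable reach₁?
        S₂ = ofDecidable reach₂?

        T₁ T₂ : Subset m
        T₁ = ofDecidable (component-edge? S₁)
        T₂ = ofDecidable (component-edge? S₂)

        split : Split G e v₁ v₂ T S₁ S₂ T₁ T₂
        split = ∈-ofDecidable reach₁? , ∈-ofDecidable reach₂?
              , ∈-ofDecidable (component-edge? S₁) , ∈-ofDecidable (component-edge? S₂)

        N₁ : NBC G _⊴_ S₁ T₁
        N₁ = component-NBC N (λ _ → proj₁) (∈-ofDecidable reach₁?) (∈-ofDecidable (component-edge? S₁))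

        N₂ : NBC G _⊴_ S₂ T₂
        N₂ = component-NBC N (λ _ → proj₁) (∈-ofDecidable reach₂?) (∈-ofDecidable (component-edge? S₂))

        index : Index G v₁ v₂ S₁ S₂
        index = (λ u → Sum.map (from (∈-ofDecidable reach₁? u)) (from (∈-ofDecidable reach₂? u)) (sides u))
              , (λ u u∈S₁ u∈S₂ → separated (to (∈-ofDecidable reach₁? u) u∈S₁ ◅◅
                                            Reach-sym (to (∈-ofDecidable reach₂? u) u∈S₂)))
              , from (∈-ofDecidable reach₁? v₁) ε , from (∈-ofDecidable reach₂? v₂) ε
              , NBC⇒connected N₁ , NBC⇒connected N₂

      tree-from-split : ∀ {T S₁ S₂ T₁ T₂} → NBC G _⊴_ ⊤ T → Split G e v₁ v₂ T S₁ S₂ T₁ T₂ →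
        T ≡ ⁅ e ⁆ ∪ (T₁ ∪ T₂)
      tree-from-split {T} {S₁} {S₂} {T₁} {T₂} N (S₁⇔ , S₂⇔ , T₁⇔ , T₂⇔) =
        Subset-ext λ f → mk⇔ (x∈p∪q⁺ ∘ decompose) (recompose ∘ x∈p∪q⁻ _ _)
        where
        open Components N using (e∈T; sides)

        in-component : ∀ {S T′ w f} → (∀ u → u ∈ S ⇔ Reach G (Minus G T e) w u) →
          (∀ f → f ∈ T′ ⇔ (Minus G T e f × EdgeIn G S f)) →
          Minus G T e f → Reach G (Minus G T e) w (proj₁ (ends f)) → f ∈ T′
        in-component {f = f} S⇔ T′⇔ f∈T∖e r =
          from (T′⇔ f) (f∈T∖e , from (S⇔ _) r , from (S⇔ _) (r ◅◅ ((f , f∈T∖e , inj₁ refl) ◅ ε)))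

        decompose : ∀ {f} → f ∈ T → f ∈ ⁅ e ⁆ ⊎ f ∈ T₁ ∪ T₂
        decompose {f} f∈T with f ≟ e
        ... | yes refl = inj₁ (x∈⁅x⁆ e)
        ... | no f≢e = inj₂ (x∈p∪q⁺ (Sum.map (in-component S₁⇔ T₁⇔ (f∈T , f≢e))
                                             (in-component S₂⇔ T₂⇔ (f∈T , f≢e)) (sides _)))

        recompose : ∀ {f} → f ∈ ⁅ e ⁆ ⊎ f ∈ T₁ ∪ T₂ → f ∈ T
        recompose {f} (inj₁ f∈⁅e⁆) = subst (_∈ T) (sym (x∈⁅y⁆⇒x≡y e f∈⁅e⁆)) e∈T
        recompose {f} (inj₂ f∈T₁∪T₂) =
          [ proj₁ ∘ proj₁ ∘ to (T₁⇔ f) , proj₁ ∘ proj₁ ∘ to (T₂⇔ f) ] (x∈p∪q⁻ T₁ T₂ f∈T₁∪T₂)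

      module Side {S S′ : Subset n} {T T′ : Subset m} {w w′ : Fin n}
        (disjoint : ∀ u → u ∈ S → u ∉ S′) (e-crosses : Joins e w w′) (w′∈S′ : w′ ∈ S′)
        (N : NBC G _⊴_ S T) (T′⊆E[S′] : ∀ f → f ∈ T′ → EdgeIn G S′ f) where
        private
          T⊆E[S] : ∀ f → f ∈ T → EdgeIn G S f
          T⊆E[S] = proj₁ N

          spanning : ∀ u v → u ∈ S → v ∈ S → Reach G (_∈ T) u v
          spanning = proj₁ (proj₂ N)

          noBC : ∀ (c : Cycle G) → CycleIn G S c → ¬ BrokenCircuitIn G _⊴_ T c
          noBC = proj₂ (proj₂ (proj₂ N))

        e∉E[S] : ¬ EdgeIn G S e
        e∉E[S] e∈E[S] = disjoint w′ (proj₂ (EdgeIn-ends e-crosses e∈E[S])) w′∈S′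

        e∉T : e ∉ T
        e∉T = e∉E[S] ∘ T⊆E[S] e

        step-stays : ∀ {f a b} → f ∈ T ⊎ f ∈ T′ → Joins f a b → a ∈ S → b ∈ S
        step-stays (inj₁ f∈T) f-joins _ = proj₂ (EdgeIn-ends f-joins (T⊆E[S] _ f∈T))
        step-stays (inj₂ f∈T′) f-joins a∈S =
          contradiction (proj₁ (EdgeIn-ends f-joins (T′⊆E[S′] _ f∈T′))) (disjoint _ a∈S)

        edge-from-S : ∀ {f a b} → f ∈ T ⊎ f ∈ T′ → Joins f a b → a ∈ S → f ∈ T
        edge-from-S (inj₁ f∈T) _ _ = f∈T
        edge-from-S (inj₂ f∈T′) f-joins a∈S =
          contradiction (proj₁ (EdgeIn-ends f-joins (T′⊆E[S′] _ f∈T′))) (disjoint _ a∈S)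

        module _ {U : Subset m} (U∖e⇔ : ∀ f → Minus G U e f ⇔ (f ∈ T ⊎ f ∈ T′)) (w∈S : w ∈ S) where

          component : ∀ u → u ∈ S ⇔ Reach G (Minus G U e) w u
          component u = mk⇔
            (λ u∈S → Reach-mono (λ f → from (U∖e⇔ f) ∘ inj₁) (spanning w u w∈S u∈S))
            (λ r → Reach-closed (λ f∈U∖e → step-stays (to (U∖e⇔ _) f∈U∖e)) r w∈S)

          component-edges : ∀ f → f ∈ T ⇔ (Minus G U e f × EdgeIn G S f)
          component-edges f = mk⇔
            (λ f∈T → from (U∖e⇔ f) (inj₁ f∈T) , T⊆E[S] f f∈T)
            (λ (f∈U∖e , f∈E[S]) → edge-from-S (to (U∖e⇔ f) f∈U∖e) (inj₁ refl) (proj₁ f∈E[S]))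

        cycle-inside : (c : Cycle G) (j : Fin (suc (Cycle.L c))) →
          (∀ i → i ≢ j → Cycle.cedge c i ∈ T ⊎ Cycle.cedge c i ∈ T′) →
          Cycle.vs c zero ∈ S → ∀ t → Cycle.vs c t ∈ S
        cycle-inside c j rest v₀∈S t =
          Reach-closed step-stays (cycle-minus-edge-connected c j rest zero t) v₀∈S

        no-broken-circuit : (c : Cycle G) (j : Fin (suc (Cycle.L c))) →
          (∀ i → Cycle.cedge c i ⊴ Cycle.cedge c j) →
          (∀ i → i ≢ j → Cycle.cedge c i ∈ T ⊎ Cycle.cedge c i ∈ T′) → Cycle.vs c zero ∈ S → ⊥
        no-broken-circuit c j max rest v₀∈S with Cycle.cedge c j ≟ e | cycle-inside c j rest v₀∈S
        ... | yes cⱼ≡e | inside =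
          e∉E[S] (subst (EdgeIn G S) cⱼ≡e (EdgeIn-intro (Cycle-joins c j) (inside (prev j)) (inside j)))
        ... | no _ | inside =
          noBC c inside (j , max , λ i i≢j → edge-from-S (rest i i≢j) (Cycle-joins c i) (inside (prev i)))

      glue : ∀ {S₁ S₂ T₁ T₂} → Index G v₁ v₂ S₁ S₂ → NBC G _⊴_ S₁ T₁ → NBC G _⊴_ S₂ T₂ →
        NBC G _⊴_ ⊤ (⁅ e ⁆ ∪ (T₁ ∪ T₂)) × Split G e v₁ v₂ (⁅ e ⁆ ∪ (T₁ ∪ T₂)) S₁ S₂ T₁ T₂
      glue {S₁} {S₂} {T₁} {T₂} (cover , disjoint , v₁∈S₁ , v₂∈S₂ , _) N₁ N₂ =
          ((λ _ _ → ∈⊤ , ∈⊤) , spanning , acyclic , noBC)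
        , side₁.component U∖e⇔ v₁∈S₁ , side₂.component U∖e⇔′ v₂∈S₂
        , side₁.component-edges U∖e⇔ v₁∈S₁ , side₂.component-edges U∖e⇔′ v₂∈S₂
        where
        U : Subset m
        U = ⁅ e ⁆ ∪ (T₁ ∪ T₂)
        module side₁ = Side disjoint e-joins v₂∈S₂ N₁ (proj₁ N₂)
        module side₂ = Side (λ u u∈S₂ u∈S₁ → disjoint u u∈S₁ u∈S₂) (Joins-sym e-joins) v₁∈S₁ N₂ (proj₁ N₁)

        e∈U : e ∈ U
        e∈U = x∈p∪q⁺ (inj₁ (x∈⁅x⁆ e))

        T₁⊆U : ∀ {f} → f ∈ T₁ → f ∈ U
        T₁⊆U = x∈p∪q⁺ ∘ inj₂ ∘ x∈p∪q⁺ ∘ inj₁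

        T₂⊆U : ∀ {f} → f ∈ T₂ → f ∈ U
        T₂⊆U = x∈p∪q⁺ ∘ inj₂ ∘ x∈p∪q⁺ ∘ inj₂

        U∖e⇔ : ∀ f → Minus G U e f ⇔ (f ∈ T₁ ⊎ f ∈ T₂)
        U∖e⇔ f = mk⇔
          (λ (f∈U , f≢e) → [ (λ f∈⁅e⁆ → contradiction (x∈⁅y⁆⇒x≡y e f∈⁅e⁆) f≢e) , x∈p∪q⁻ T₁ T₂ ]
                             (x∈p∪q⁻ ⁅ e ⁆ (T₁ ∪ T₂) f∈U))
          (λ f∈T₁∪T₂ → [ T₁⊆U , T₂⊆U ] f∈T₁∪T₂ , λ { refl → [ side₁.e∉T , side₂.e∉T ] f∈T₁∪T₂ })

        U∖e⇔′ : ∀ f → Minus G U e f ⇔ (f ∈ T₂ ⊎ f ∈ T₁)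
        U∖e⇔′ f = mk⇔ (swap ∘ to (U∖e⇔ f)) (from (U∖e⇔ f) ∘ swap)

        reaches-v₁ : ∀ u → Reach G (_∈ U) u v₁
        reaches-v₁ u with cover u
        ... | inj₁ u∈S₁ = Reach-mono (λ _ → T₁⊆U) (proj₁ (proj₂ N₁) u v₁ u∈S₁ v₁∈S₁)
        ... | inj₂ u∈S₂ = Reach-mono (λ _ → T₂⊆U) (proj₁ (proj₂ N₂) u v₂ u∈S₂ v₂∈S₂)
                        ◅◅ (e , e∈U , Joins-sym e-joins) ◅ ε

        spanning : ∀ u v → u ∈ ⊤ → v ∈ ⊤ → Reach G (_∈ U) u v
        spanning u v _ _ = reaches-v₁ u ◅◅ Reach-sym (reaches-v₁ v)

        noBC : NoBrokenCircuit U
        noBC c _ (j , max , rest) = [ side₁.no-broken-circuit c j max others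
                                    , side₂.no-broken-circuit c j max (λ i → swap ∘ others i) ]
                                    (cover (Cycle.vs c zero))
          where
          others : ∀ i → i ≢ j → Cycle.cedge c i ∈ T₁ ⊎ Cycle.cedge c i ∈ T₂
          others i i≢j = to (U∖e⇔ _) (rest i i≢j , other-cycle-edges≢greatest c max greatest i i≢j)

        acyclic : ∀ (c : Cycle G) → ¬ (∀ i → Cycle.cedge c i ∈ U)
        acyclic c c⊆U = noBC c (λ _ → ∈⊤) (cycle-has-broken-circuit c c⊆U)

lemma2p22 : ∀ {n} (G : Graph n) (_⊴_ : Rel (Fin (Graph.m G)) 0ℓ) →
    IsTotalOrder _≡_ _⊴_ →
    (e : Fin (Graph.m G)) → (∀ f → f ⊴ e) →
    (v₁ v₂ : Fin n) → Graph.Joins G e v₁ v₂ →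
      (∀ T → NBC G _⊴_ ⊤ T →
        ∃ λ S₁ → ∃ λ S₂ → ∃ λ T₁ → ∃ λ T₂ →
          Index G v₁ v₂ S₁ S₂ × Split G e v₁ v₂ T S₁ S₂ T₁ T₂
          × NBC G _⊴_ S₁ T₁ × NBC G _⊴_ S₂ T₂)
    × (∀ T T′ S₁ S₂ T₁ T₂ → NBC G _⊴_ ⊤ T → NBC G _⊴_ ⊤ T′ →
        Split G e v₁ v₂ T S₁ S₂ T₁ T₂ → Split G e v₁ v₂ T′ S₁ S₂ T₁ T₂ → T ≡ T′)
    × (∀ S₁ S₂ T₁ T₂ → Index G v₁ v₂ S₁ S₂ →
        NBC G _⊴_ S₁ T₁ → NBC G _⊴_ S₂ T₂ →
        ∃ λ T → NBC G _⊴_ ⊤ T × Split G e v₁ v₂ T S₁ S₂ T₁ T₂)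
lemma2p22 G _⊴_ isTotalOrder e greatest v₁ v₂ e-joins =
    (λ T N → let open Components N in S₁ , S₂ , T₁ , T₂ , index , split , N₁ , N₂)
  , (λ T T′ _ _ _ _ N N′ split split′ →
       trans (tree-from-split N split) (sym (tree-from-split N′ split′)))
  , (λ _ _ _ _ index N₁ N₂ → _ , glue index N₁ N₂)
  where open Bijection G _⊴_ isTotalOrder greatest e-joins
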